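{- Let $(W_i)_{i\ge1}$ be a Fibonacci sequence in ${\mathcal{P}}$. If $W_1$ and $W_2$ do not have a common eigenvector in $\mathbb{Q}^2$ and satisfy $W_1W_2\ne\pm W_2W_1$, then $(W_i)_{i\ge1}$ is admissible.
   Context: ${\mathcal{P}}$ is the set of primitive (entries with gcd 1) integer $2\times2$ matrices with non-zero determinant, a group under $A*B=(AB)^{\mathrm{red}}$, where $C^{\mathrm{red}}$ is $C$ divided by the positive gcd of its entries. A Fibonacci sequence in ${\mathcal{P}}$ satisfies $W_{i+2}=W_{i+1}*W_i$ for all $i\ge1$. It is admissible if there is $N\in{\mathcal{P}}$, neither symmetric nor skew-symmetric, such that $W_iN_i$ is symmetric for every $i\ge1$, where $N_i={}^tN$ for $i$ odd and $N_i=N$ for $i$ even. -}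

module Defs where

open import Data.Nat as ℕ using (ℕ; zero; suc; _≤_)
open import Data.Nat.GCD using (gcd)
open import Data.Integer as ℤ using (ℤ; +_; ∣_∣; _/ℕ_)
open import Data.Rational as ℚ using (ℚ)
open import Data.Product using (Σ; _×_; ∃; ∃-syntax)
open import Relation.Nullary using (¬_)
open import Relation.Binary.PropositionalEquality using (_≡_; _≢_)

-- integer 2×2 matrix  [ a b ; c d ]
record Mat : Set where
  constructor mat
  field
    a b c d : ℤ
open Mat public

_·_ : Mat → Mat → Mat
mat a₁ b₁ c₁ d₁ · mat a₂ b₂ c₂ d₂ =
  mat (a₁ ℤ.* a₂ ℤ.+ b₁ ℤ.* c₂) (a₁ ℤ.* b₂ ℤ.+ b₁ ℤ.* d₂)
      (c₁ ℤ.* a₂ ℤ.+ d₁ ℤ.* c₂) (c₁ ℤ.* b₂ ℤ.+ d₁ ℤ.* d₂)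

negM : Mat → Mat
negM (mat a b c d) = mat (ℤ.- a) (ℤ.- b) (ℤ.- c) (ℤ.- d)

tr : Mat → Mat
tr (mat a b c d) = mat a c b d

det : Mat → ℤ
det (mat a b c d) = a ℤ.* d ℤ.- b ℤ.* c

content : Mat → ℕ
content (mat a b c d) = gcd (gcd ∣ a ∣ ∣ b ∣) (gcd ∣ c ∣ ∣ d ∣)

-- C^red : C divided by the positive gcd of its entries (zero matrix left unchanged)
red : Mat → Mat
red C with content C
... | zero  = C
... | suc k = mat (a C /ℕ suc k) (b C /ℕ suc k) (c C /ℕ suc k) (d C /ℕ suc k)

_⊛_ : Mat → Mat → Mat
A ⊛ B = red (A · B)

Primitive : Mat → Set
Primitive C = content C ≡ 1

InP : Mat → Set
InP C = Primitive C × det C ≢ ℤ.0ℤ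

Symmetric : Mat → Set
Symmetric C = tr C ≡ C

SkewSymmetric : Mat → Set
SkewSymmetric C = tr C ≡ negM C

-- Fibonacci sequence in 𝒫, indexed by i ≥ 1 (the value at index 0 is ignored)
FibonacciInP : (ℕ → Mat) → Set
FibonacciInP W =
  (∀ i → 1 ≤ i → InP (W i)) ×
  (∀ i → 1 ≤ i → W (suc (suc i)) ≡ W (suc i) ⊛ W i)

Nidx : Mat → ℕ → Mat
Nidx N zero          = N
Nidx N (suc zero)    = tr N
Nidx N (suc (suc i)) = Nidx N i

Admissible : (ℕ → Mat) → Set
Admissible W =
  ∃[ N ] (InP N × ¬ Symmetric N × ¬ SkewSymmetric N ×
          (∀ i → 1 ≤ i → Symmetric (W i · Nidx N i)))

toℚ : ℤ → ℚ
toℚ z = z ℚ./ 1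

IsEigvec : Mat → ℚ → ℚ → ℚ → Set
IsEigvec (mat a b c d) x y λ′ =
  (toℚ a ℚ.* x ℚ.+ toℚ b ℚ.* y ≡ λ′ ℚ.* x) ×
  (toℚ c ℚ.* x ℚ.+ toℚ d ℚ.* y ≡ λ′ ℚ.* y)

CommonEigenvector : Mat → Mat → Set
CommonEigenvector A B =
  Σ ℚ λ x → Σ ℚ λ y →
    ¬ (x ≡ ℚ.0ℚ × y ≡ ℚ.0ℚ) ×
    (∃[ λ₁ ] IsEigvec A x y λ₁) × (∃[ λ₂ ] IsEigvec B x y λ₂)

{-# OPTIONS --safe #-}
-- Write asym M = b M - c M, so that M is symmetric iff asym M = 0.  For 2×2 matrices
-- Cayley–Hamilton gives asym (Y X Y M) = tr (X Y) · asym (Y M) + det Y · asym (X Mᵗ); hence if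
-- W_i N_i, W_(i+1) N_(i+1) and W_(i+1) W_i N_i are symmetric, then so are W_(i+2) N_(i+2) and
-- W_(i+2) W_(i+1) N_(i+1) (reduction only divides by positive scalars), and it suffices to start
-- the induction at i = 1.  With A = W₁ and B = W₂ take N the primitive part of [A,B] B A J.  The
-- three starting conditions reduce to trace identities; asym ([A,B] B A J) = det [A,B], which is
-- nonzero since otherwise the kernel of the nonzero traceless matrix [A,B] would be a common
-- eigenvector; and a skew-symmetric N would force tr A = tr B = tr (B A) = 0, whence A B = -B A.
module Submission where

open import Defs
open import Algebra.Bundles using (AbelianGroup)
open import Data.Nat as ℕ using (ℕ; zero; suc; _≤_; s≤s; z≤n)
import Data.Nat.Properties as ℕP
open import Data.Nat.Divisibility using (_∣_; ∣-trans; n∣m⇒m%n≡0)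
open import Data.Nat.GCD
  using (gcd; gcd[m,n]∣m; gcd[m,n]∣n; c*gcd[m,n]≡gcd[cm,cn]; gcd[m,n]≡0⇒m≡0; gcd[m,n]≡0⇒n≡0)
open import Data.Integer as ℤ
  using (ℤ; +_; +[1+_]; -[1+_]; ∣_∣; _/ℕ_; _%ℕ_; _+_; _*_; _-_; -_; 0ℤ; 1ℤ)
import Data.Integer.Properties as ℤP
open import Data.Integer.DivMod using (a≡a%ℕn+[a/ℕn]*n)
open import Data.Integer.Tactic.RingSolver using (solve-∀)
open import Data.Rational as ℚ using (ℚ)
import Data.Rational.Properties as ℚP
import Data.Rational.Unnormalised as ℚᵘ
import Data.Rational.Unnormalised.Properties as ℚᵘP
open import Data.Product using (_×_; _,_; ∃₂; ∃-syntax; proj₁; proj₂)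
open import Data.Sum using (_⊎_; inj₁; inj₂; [_,_]′)
open import Function using (_∘_)
open import Relation.Nullary using (¬_; Dec; yes; no; contradiction)
open import Relation.Binary.PropositionalEquality
  using (_≡_; _≢_; refl; sym; trans; cong; cong₂; subst; module ≡-Reasoning)
open import Algebra.Properties.Group (AbelianGroup.group ℤP.+-0-abelianGroup)
  using (inverseˡ-unique; inverseʳ-unique)

infixr 7 _⊙_
infixl 6 _⊕_ _⊖_

_⊙_ : ℤ → Mat → Mat
g ⊙ M = mat (g * a M) (g * b M) (g * c M) (g * d M)

_⊕_ _⊖_ : Mat → Mat → Mat
P ⊕ Q = mat (a P + a Q) (b P + b Q) (c P + c Q) (d P + d Q)
P ⊖ Q = mat (a P - a Q) (b P - b Q) (c P - c Q) (d P - d Q)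

O I J : Mat
O = mat 0ℤ 0ℤ 0ℤ 0ℤ
I = mat 1ℤ 0ℤ 0ℤ 1ℤ
J = mat 0ℤ 1ℤ (- 1ℤ) 0ℤ

adj : Mat → Mat
adj M = mat (d M) (- b M) (- c M) (a M)

[_,_] : Mat → Mat → Mat
[ A , B ] = A · B ⊖ B · A

trace asym : Mat → ℤ
trace M = a M + d M
asym M = b M - c M

-- The determinant of the pair (M u, u): for u ≠ 0 it vanishes iff u is an eigenvector of M.
cross : Mat → ℤ → ℤ → ℤ
cross M u₁ u₂ = (a M * u₁ + b M * u₂) * u₂ - (c M * u₁ + d M * u₂) * u₁

mat-≡ : ∀ {P Q} → a P ≡ a Q → b P ≡ b Q → c P ≡ c Q → d P ≡ d Q → P ≡ Q
mat-≡ {mat _ _ _ _} {mat _ _ _ _} refl refl refl refl = refl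

*-≢0 : ∀ {x y} → x ≢ 0ℤ → y ≢ 0ℤ → x * y ≢ 0ℤ
*-≢0 {x} x≢0 y≢0 = [ x≢0 , y≢0 ]′ ∘ ℤP.i*j≡0⇒i≡0∨j≡0 x

*-cancel-≢0 : ∀ {x y} → x ≢ 0ℤ → x * y ≡ 0ℤ → y ≡ 0ℤ
*-cancel-≢0 {x} x≢0 xy≡0 with ℤP.i*j≡0⇒i≡0∨j≡0 x xy≡0
... | inj₁ x≡0 = contradiction x≡0 x≢0
... | inj₂ y≡0 = y≡0

x≡-x⇒x≡0 : ∀ {x} → x ≡ - x → x ≡ 0ℤ
x≡-x⇒x≡0 {+ zero}   _ = refl
x≡-x⇒x≡0 {+[1+ _ ]} ()
x≡-x⇒x≡0 { -[1+ _ ]} ()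

·-assoc : ∀ X Y Z → (X · Y) · Z ≡ X · (Y · Z)
·-assoc (mat x₁ x₂ x₃ x₄) (mat y₁ y₂ y₃ y₄) (mat z₁ z₂ z₃ z₄) =
  mat-≡ (entry x₁ x₂ y₁ y₂ y₃ y₄ z₁ z₃) (entry x₁ x₂ y₁ y₂ y₃ y₄ z₂ z₄)
        (entry x₃ x₄ y₁ y₂ y₃ y₄ z₁ z₃) (entry x₃ x₄ y₁ y₂ y₃ y₄ z₂ z₄)
  where
  entry : ∀ p q r s t w u v → (p * r + q * t) * u + (p * s + q * w) * v ≡ p * (r * u + s * v) + q * (t * u + w * v)
  entry = solve-∀

⊙-· : ∀ g X Y → (g ⊙ X) · Y ≡ g ⊙ (X · Y)
⊙-· g (mat x₁ x₂ x₃ x₄) (mat y₁ y₂ y₃ y₄) =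
  mat-≡ (entry g x₁ x₂ y₁ y₃) (entry g x₁ x₂ y₂ y₄) (entry g x₃ x₄ y₁ y₃) (entry g x₃ x₄ y₂ y₄)
  where
  entry : ∀ g p q r s → (g * p) * r + (g * q) * s ≡ g * (p * r + q * s)
  entry = solve-∀

·-⊙ : ∀ g X Y → X · (g ⊙ Y) ≡ g ⊙ (X · Y)
·-⊙ g (mat x₁ x₂ x₃ x₄) (mat y₁ y₂ y₃ y₄) =
  mat-≡ (entry g x₁ x₂ y₁ y₃) (entry g x₁ x₂ y₂ y₄) (entry g x₃ x₄ y₁ y₃) (entry g x₃ x₄ y₂ y₄)
  where
  entry : ∀ g p q r s → p * (g * r) + q * (g * s) ≡ g * (p * r + q * s)
  entry = solve-∀

·-⊖ : ∀ X Y Z → X · (Y ⊖ Z) ≡ X · Y ⊖ X · Z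
·-⊖ (mat x₁ x₂ x₃ x₄) (mat y₁ y₂ y₃ y₄) (mat z₁ z₂ z₃ z₄) =
  mat-≡ (entry x₁ x₂ y₁ y₃ z₁ z₃) (entry x₁ x₂ y₂ y₄ z₂ z₄)
        (entry x₃ x₄ y₁ y₃ z₁ z₃) (entry x₃ x₄ y₂ y₄ z₂ z₄)
  where
  entry : ∀ p q r s u v → p * (r - u) + q * (s - v) ≡ (p * r + q * s) - (p * u + q * v)
  entry = solve-∀

det-· : ∀ X Y → det (X · Y) ≡ det X * det Y
det-· (mat x₁ x₂ x₃ x₄) (mat y₁ y₂ y₃ y₄) = identity x₁ x₂ x₃ x₄ y₁ y₂ y₃ y₄
  where
  identity : ∀ x₁ x₂ x₃ x₄ y₁ y₂ y₃ y₄ →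
    (x₁ * y₁ + x₂ * y₃) * (x₃ * y₂ + x₄ * y₄) - (x₁ * y₂ + x₂ * y₄) * (x₃ * y₁ + x₄ * y₃)
    ≡ (x₁ * x₄ - x₂ * x₃) * (y₁ * y₄ - y₂ * y₃)
  identity = solve-∀

det-⊙ : ∀ g X → det (g ⊙ X) ≡ g * g * det X
det-⊙ g (mat x₁ x₂ x₃ x₄) = identity g x₁ x₂ x₃ x₄
  where
  identity : ∀ g x₁ x₂ x₃ x₄ →
    (g * x₁) * (g * x₄) - (g * x₂) * (g * x₃) ≡ g * g * (x₁ * x₄ - x₂ * x₃)
  identity = solve-∀

trace-⊖ : ∀ P Q → trace (P ⊖ Q) ≡ trace P - trace Q
trace-⊖ (mat p₁ _ _ p₄) (mat q₁ _ _ q₄) = identity p₁ p₄ q₁ q₄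
  where
  identity : ∀ p₁ p₄ q₁ q₄ → (p₁ - q₁) + (p₄ - q₄) ≡ (p₁ + p₄) - (q₁ + q₄)
  identity = solve-∀

trace-·-comm : ∀ X Y → trace (X · Y) ≡ trace (Y · X)
trace-·-comm (mat x₁ x₂ x₃ x₄) (mat y₁ y₂ y₃ y₄) = identity x₁ x₂ x₃ x₄ y₁ y₂ y₃ y₄
  where
  identity : ∀ x₁ x₂ x₃ x₄ y₁ y₂ y₃ y₄ →
    (x₁ * y₁ + x₂ * y₃) + (x₃ * y₂ + x₄ * y₄) ≡ (y₁ * x₁ + y₂ * x₃) + (y₃ * x₂ + y₄ * x₄)
  identity = solve-∀

trace-·-·-adj : ∀ P X → trace ((P · X) · adj X) ≡ det X * trace P
trace-·-·-adj (mat p₁ p₂ p₃ p₄) (mat x₁ x₂ x₃ x₄) = identity p₁ p₂ p₃ p₄ x₁ x₂ x₃ x₄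
  where
  identity : ∀ p₁ p₂ p₃ p₄ x₁ x₂ x₃ x₄ →
    ((p₁ * x₁ + p₂ * x₃) * x₄ + (p₁ * x₂ + p₂ * x₄) * - x₃)
      + ((p₃ * x₁ + p₄ * x₃) * - x₂ + (p₃ * x₂ + p₄ * x₄) * x₁)
    ≡ (x₁ * x₄ - x₂ * x₃) * (p₁ + p₄)
  identity = solve-∀

asym-·J : ∀ Q → asym (Q · J) ≡ trace Q
asym-·J (mat q₁ q₂ q₃ q₄) = identity q₁ q₂ q₃ q₄
  where
  identity : ∀ q₁ q₂ q₃ q₄ → (q₁ * 1ℤ + q₂ * 0ℤ) - (q₃ * 0ℤ + q₄ * - 1ℤ) ≡ q₁ + q₄
  identity = solve-∀

asym-·-tr-·J : ∀ X Q → asym (X · tr (Q · J)) ≡ - trace (Q · adj X)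
asym-·-tr-·J (mat x₁ x₂ x₃ x₄) (mat q₁ q₂ q₃ q₄) = identity x₁ x₂ x₃ x₄ q₁ q₂ q₃ q₄
  where
  identity : ∀ x₁ x₂ x₃ x₄ q₁ q₂ q₃ q₄ →
    (x₁ * (q₃ * 0ℤ + q₄ * - 1ℤ) + x₂ * (q₃ * 1ℤ + q₄ * 0ℤ))
      - (x₃ * (q₁ * 0ℤ + q₂ * - 1ℤ) + x₄ * (q₁ * 1ℤ + q₂ * 0ℤ))
    ≡ - ((q₁ * x₄ + q₂ * - x₃) + (q₃ * - x₂ + q₄ * x₁))
  identity = solve-∀

asym-·-·-· : ∀ X Y M → asym (((Y · X) · Y) · M) ≡ trace (X · Y) * asym (Y · M) + det Y * asym (X · tr M)
asym-·-·-· (mat x₁ x₂ x₃ x₄) (mat y₁ y₂ y₃ y₄) (mat m₁ m₂ m₃ m₄) =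
  identity x₁ x₂ x₃ x₄ y₁ y₂ y₃ y₄ m₁ m₂ m₃ m₄
  where
  identity : ∀ x₁ x₂ x₃ x₄ y₁ y₂ y₃ y₄ m₁ m₂ m₃ m₄ →
    let p₁ = y₁ * x₁ + y₂ * x₃ ; p₂ = y₁ * x₂ + y₂ * x₄
        p₃ = y₃ * x₁ + y₄ * x₃ ; p₄ = y₃ * x₂ + y₄ * x₄
        q₁ = p₁ * y₁ + p₂ * y₃ ; q₂ = p₁ * y₂ + p₂ * y₄
        q₃ = p₃ * y₁ + p₄ * y₃ ; q₄ = p₃ * y₂ + p₄ * y₄
    in (q₁ * m₂ + q₂ * m₄) - (q₃ * m₁ + q₄ * m₃)
       ≡ ((x₁ * y₁ + x₂ * y₃) + (x₃ * y₂ + x₄ * y₄)) * ((y₁ * m₂ + y₂ * m₄) - (y₃ * m₁ + y₄ * m₃))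
         + (y₁ * y₄ - y₂ * y₃) * ((x₁ * m₃ + x₂ * m₄) - (x₃ * m₁ + x₄ * m₂))
  identity = solve-∀

trace-·-[,] : ∀ X Y Z → trace (X · [ Y , Z ]) ≡ trace (X · (Y · Z)) - trace (X · (Z · Y))
trace-·-[,] X Y Z = trans (cong trace (·-⊖ X (Y · Z) (Z · Y))) (trace-⊖ (X · (Y · Z)) (X · (Z · Y)))

trace-[,] : ∀ A B → trace [ A , B ] ≡ 0ℤ
trace-[,] A B = trans (trace-⊖ (A · B) (B · A)) (ℤP.i≡j⇒i-j≡0 (trace-·-comm A B))

trace-A·[A,B] : ∀ A B → trace (A · [ A , B ]) ≡ 0ℤ
trace-A·[A,B] A B = trans (trace-·-[,] A A B) (ℤP.i≡j⇒i-j≡0 (begin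
  trace (A · (A · B))  ≡⟨ trace-·-comm A (A · B) ⟩
  trace ((A · B) · A)  ≡⟨ cong trace (·-assoc A B A) ⟩
  trace (A · (B · A))  ∎))
  where open ≡-Reasoning

trace-B·[A,B] : ∀ A B → trace (B · [ A , B ]) ≡ 0ℤ
trace-B·[A,B] A B = trans (trace-·-[,] B A B) (ℤP.i≡j⇒i-j≡0 (begin
  trace (B · (A · B))  ≡⟨ cong trace (·-assoc B A B) ⟨
  trace ((B · A) · B)  ≡⟨ trace-·-comm (B · A) B ⟩
  trace (B · (B · A))  ∎))
  where open ≡-Reasoning

trace-[A,B]·B·A : ∀ A B → trace (([ A , B ] · B) · A) ≡ det [ A , B ]
trace-[A,B]·B·A (mat a₁ a₂ a₃ a₄) (mat b₁ b₂ b₃ b₄) = identity a₁ a₂ a₃ a₄ b₁ b₂ b₃ b₄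
  where
  identity : ∀ a₁ a₂ a₃ a₄ b₁ b₂ b₃ b₄ →
    let k₁ = (a₁ * b₁ + a₂ * b₃) - (b₁ * a₁ + b₂ * a₃)
        k₂ = (a₁ * b₂ + a₂ * b₄) - (b₁ * a₂ + b₂ * a₄)
        k₃ = (a₃ * b₁ + a₄ * b₃) - (b₃ * a₁ + b₄ * a₃)
        k₄ = (a₃ * b₂ + a₄ * b₄) - (b₃ * a₂ + b₄ * a₄)
    in ((k₁ * b₁ + k₂ * b₃) * a₁ + (k₁ * b₂ + k₂ * b₄) * a₃)
         + ((k₃ * b₁ + k₄ * b₃) * a₂ + (k₃ * b₂ + k₄ * b₄) * a₄)
       ≡ k₁ * k₄ - k₂ * k₃
  identity = solve-∀

trace-B·[A,B]·B·A : ∀ A B → trace (B · (([ A , B ] · B) · A)) ≡ 0ℤ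
trace-B·[A,B]·B·A (mat a₁ a₂ a₃ a₄) (mat b₁ b₂ b₃ b₄) = identity a₁ a₂ a₃ a₄ b₁ b₂ b₃ b₄
  where
  identity : ∀ a₁ a₂ a₃ a₄ b₁ b₂ b₃ b₄ →
    let k₁ = (a₁ * b₁ + a₂ * b₃) - (b₁ * a₁ + b₂ * a₃)
        k₂ = (a₁ * b₂ + a₂ * b₄) - (b₁ * a₂ + b₂ * a₄)
        k₃ = (a₃ * b₁ + a₄ * b₃) - (b₃ * a₁ + b₄ * a₃)
        k₄ = (a₃ * b₂ + a₄ * b₄) - (b₃ * a₂ + b₄ * a₄)
        q₁ = (k₁ * b₁ + k₂ * b₃) * a₁ + (k₁ * b₂ + k₂ * b₄) * a₃
        q₂ = (k₁ * b₁ + k₂ * b₃) * a₂ + (k₁ * b₂ + k₂ * b₄) * a₄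
        q₃ = (k₃ * b₁ + k₄ * b₃) * a₁ + (k₃ * b₂ + k₄ * b₄) * a₃
        q₄ = (k₃ * b₁ + k₄ * b₃) * a₂ + (k₃ * b₂ + k₄ * b₄) * a₄
    in (b₁ * q₁ + b₂ * q₃) + (b₃ * q₂ + b₄ * q₄) ≡ 0ℤ
  identity = solve-∀

polarised-cayley-hamilton : ∀ A B →
  A · B ⊕ B · A ≡ trace A ⊙ B ⊕ trace B ⊙ A ⊕ (trace (B · A) - trace A * trace B) ⊙ I
polarised-cayley-hamilton (mat a₁ a₂ a₃ a₄) (mat b₁ b₂ b₃ b₄) =
  mat-≡ (entry₁ a₁ a₂ a₃ a₄ b₁ b₂ b₃ b₄) (entry₂ a₁ a₂ a₃ a₄ b₁ b₂ b₃ b₄)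
        (entry₃ a₁ a₂ a₃ a₄ b₁ b₂ b₃ b₄) (entry₄ a₁ a₂ a₃ a₄ b₁ b₂ b₃ b₄)
  where
  entry₁ : ∀ a₁ a₂ a₃ a₄ b₁ b₂ b₃ b₄ →
    let t = ((b₁ * a₁ + b₂ * a₃) + (b₃ * a₂ + b₄ * a₄)) - (a₁ + a₄) * (b₁ + b₄) in
    (a₁ * b₁ + a₂ * b₃) + (b₁ * a₁ + b₂ * a₃) ≡ ((a₁ + a₄) * b₁ + (b₁ + b₄) * a₁) + t * 1ℤ
  entry₁ = solve-∀
  entry₂ : ∀ a₁ a₂ a₃ a₄ b₁ b₂ b₃ b₄ →
    let t = ((b₁ * a₁ + b₂ * a₃) + (b₃ * a₂ + b₄ * a₄)) - (a₁ + a₄) * (b₁ + b₄) in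
    (a₁ * b₂ + a₂ * b₄) + (b₁ * a₂ + b₂ * a₄) ≡ ((a₁ + a₄) * b₂ + (b₁ + b₄) * a₂) + t * 0ℤ
  entry₂ = solve-∀
  entry₃ : ∀ a₁ a₂ a₃ a₄ b₁ b₂ b₃ b₄ →
    let t = ((b₁ * a₁ + b₂ * a₃) + (b₃ * a₂ + b₄ * a₄)) - (a₁ + a₄) * (b₁ + b₄) in
    (a₃ * b₁ + a₄ * b₃) + (b₃ * a₁ + b₄ * a₃) ≡ ((a₁ + a₄) * b₃ + (b₁ + b₄) * a₃) + t * 0ℤ
  entry₃ = solve-∀
  entry₄ : ∀ a₁ a₂ a₃ a₄ b₁ b₂ b₃ b₄ →
    let t = ((b₁ * a₁ + b₂ * a₃) + (b₃ * a₂ + b₄ * a₄)) - (a₁ + a₄) * (b₁ + b₄) in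
    (a₃ * b₂ + a₄ * b₄) + (b₃ * a₂ + b₄ * a₄) ≡ ((a₁ + a₄) * b₄ + (b₁ + b₄) * a₄) + t * 1ℤ
  entry₄ = solve-∀

⊕≡O⇒≡negM : ∀ {P Q} → P ⊕ Q ≡ O → P ≡ negM Q
⊕≡O⇒≡negM e = mat-≡ (inverseˡ-unique _ _ (cong a e)) (inverseˡ-unique _ _ (cong b e))
                    (inverseˡ-unique _ _ (cong c e)) (inverseˡ-unique _ _ (cong d e))

⊖≡O⇒≡ : ∀ {P Q} → P ⊖ Q ≡ O → P ≡ Q
⊖≡O⇒≡ e = mat-≡ (ℤP.i-j≡0⇒i≡j _ _ (cong a e)) (ℤP.i-j≡0⇒i≡j _ _ (cong b e))
                (ℤP.i-j≡0⇒i≡j _ _ (cong c e)) (ℤP.i-j≡0⇒i≡j _ _ (cong d e))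

anticommute-of-traceless : ∀ A B → trace A ≡ 0ℤ → trace B ≡ 0ℤ → trace (B · A) ≡ 0ℤ →
  A · B ≡ negM (B · A)
anticommute-of-traceless A B tA tB tBA = ⊕≡O⇒≡negM (trans (polarised-cayley-hamilton A B) vanishes)
  where
  vanishes : trace A ⊙ B ⊕ trace B ⊙ A ⊕ (trace (B · A) - trace A * trace B) ⊙ I ≡ O
  vanishes rewrite tA | tB | tBA = refl

c≡b⇒symmetric : ∀ {M} → c M ≡ b M → Symmetric M
c≡b⇒symmetric e = mat-≡ refl e (sym e) refl

symmetric⇒asym≡0 : ∀ {M} → Symmetric M → asym M ≡ 0ℤ
symmetric⇒asym≡0 e = ℤP.i≡j⇒i-j≡0 (cong c e)

asym≡0⇒symmetric : ∀ {M} → asym M ≡ 0ℤ → Symmetric M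
asym≡0⇒symmetric e = c≡b⇒symmetric (sym (ℤP.i-j≡0⇒i≡j _ _ e))

symmetric-⊙ : ∀ g {M} → Symmetric M → Symmetric (g ⊙ M)
symmetric-⊙ g e = cong (g ⊙_) e

symmetric-⊙-cancel : ∀ g .{{_ : ℤ.NonZero g}} {M} → Symmetric (g ⊙ M) → Symmetric M
symmetric-⊙-cancel g e = c≡b⇒symmetric (ℤP.*-cancelˡ-≡ g _ _ (cong b e))

symmetric-of-multiple : ∀ g .{{_ : ℤ.NonZero g}} {P Q} → P ≡ g ⊙ Q → Symmetric P → Symmetric Q
symmetric-of-multiple g P≡gQ = symmetric-⊙-cancel g ∘ subst Symmetric P≡gQ

symmetric-·-·-· : ∀ X Y M → Symmetric (Y · M) → Symmetric (X · tr M) → Symmetric (((Y · X) · Y) · M)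
symmetric-·-·-· X Y M sym-YM sym-XMᵀ = asym≡0⇒symmetric (begin
  asym (((Y · X) · Y) · M)
    ≡⟨ asym-·-·-· X Y M ⟩
  trace (X · Y) * asym (Y · M) + det Y * asym (X · tr M)
    ≡⟨ cong₂ (λ u v → trace (X · Y) * u + det Y * v) (symmetric⇒asym≡0 sym-YM) (symmetric⇒asym≡0 sym-XMᵀ) ⟩
  trace (X · Y) * 0ℤ + det Y * 0ℤ
    ≡⟨ cong₂ _+_ (ℤP.*-zeroʳ (trace (X · Y))) (ℤP.*-zeroʳ (det Y)) ⟩
  0ℤ ∎)
  where open ≡-Reasoning

-- The induction invariant at index i, for X = W i, Y = W (i + 1) and M = N_(i+1); its third
-- component is what lets the symmetry of W_(i+2) N_(i+2) be proved at the next step.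
Compatible : Mat → Mat → Mat → Set
Compatible X Y M = Symmetric (X · tr M) × Symmetric (Y · M) × Symmetric ((Y · X) · tr M)

compatible-step : ∀ s .{{_ : ℤ.NonZero s}} X Y R M → Y · X ≡ s ⊙ R → Compatible X Y M → Compatible Y R (tr M)
compatible-step s X Y R M YX≡sR (sym-XMᵀ , sym-YM , sym-YXMᵀ) =
  sym-YM ,
  symmetric-of-multiple s (trans (cong (_· tr M) YX≡sR) (⊙-· s R (tr M))) sym-YXMᵀ ,
  symmetric-of-multiple s YXYM≡s[RYM] (symmetric-·-·-· X Y M sym-YM sym-XMᵀ)
  where
  open ≡-Reasoning
  YXYM≡s[RYM] : ((Y · X) · Y) · M ≡ s ⊙ ((R · Y) · M)
  YXYM≡s[RYM] = begin
    ((Y · X) · Y) · M        ≡⟨ cong (λ Z → (Z · Y) · M) YX≡sR ⟩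
    ((s ⊙ R) · Y) · M        ≡⟨ cong (_· M) (⊙-· s R Y) ⟩
    (s ⊙ (R · Y)) · M        ≡⟨ ⊙-· s (R · Y) M ⟩
    s ⊙ ((R · Y) · M)        ∎

compatible-⊙-cancel : ∀ s .{{_ : ℤ.NonZero s}} A B N → Compatible A B (s ⊙ N) → Compatible A B N
compatible-⊙-cancel s A B N (sym-A , sym-B , sym-BA) =
  symmetric-of-multiple s (·-⊙ s A (tr N)) sym-A ,
  symmetric-of-multiple s (·-⊙ s B N) sym-B ,
  symmetric-of-multiple s (·-⊙ s (B · A) (tr N)) sym-BA

Nidx-tr : ∀ N i → Nidx N i ≡ tr (Nidx N (suc i))
Nidx-tr N zero          = refl
Nidx-tr N (suc zero)    = refl
Nidx-tr N (suc (suc i)) = Nidx-tr N i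

compatible-everywhere : ∀ (W : ℕ → Mat) N →
  (∀ i → 1 ≤ i → ∃[ k ] W (suc i) · W i ≡ +[1+ k ] ⊙ W (suc (suc i))) →
  Compatible (W 1) (W 2) N → ∀ i → 1 ≤ i → Symmetric (W i · Nidx N i)
compatible-everywhere W N multiple base (suc i) _ =
  subst (λ M → Symmetric (W (suc i) · M)) (sym (Nidx-tr N (suc i))) (proj₁ (compatible-from i))
  where
  compatible-from : ∀ i → Compatible (W (suc i)) (W (suc (suc i))) (Nidx N (suc (suc i)))
  compatible-from zero    = base
  compatible-from (suc i) with multiple (suc i) (s≤s z≤n)
  ... | k , W₃W₂≡sW₄ =
    subst (Compatible (W (suc (suc i))) (W (suc (suc (suc i))))) (sym (Nidx-tr N (suc i)))
      (compatible-step +[1+ k ] (W (suc i)) (W (suc (suc i))) (W (suc (suc (suc i)))) (Nidx N (suc (suc i)))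
        W₃W₂≡sW₄ (compatible-from i))

content-⊙ : ∀ g R → content (+ g ⊙ R) ≡ g ℕ.* content R
content-⊙ g R
  rewrite ℤP.abs-* (+ g) (a R) | ℤP.abs-* (+ g) (b R) | ℤP.abs-* (+ g) (c R) | ℤP.abs-* (+ g) (d R)
        | sym (c*gcd[m,n]≡gcd[cm,cn] g ∣ a R ∣ ∣ b R ∣) | sym (c*gcd[m,n]≡gcd[cm,cn] g ∣ c R ∣ ∣ d R ∣)
  = sym (c*gcd[m,n]≡gcd[cm,cn] g _ _)

content≡0⇒≡O : ∀ C → content C ≡ 0 → C ≡ O
content≡0⇒≡O C content≡0 =
  mat-≡ (ℤP.∣i∣≡0⇒i≡0 (gcd[m,n]≡0⇒m≡0 ab≡0))
        (ℤP.∣i∣≡0⇒i≡0 (gcd[m,n]≡0⇒n≡0 ∣ a C ∣ ab≡0))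
        (ℤP.∣i∣≡0⇒i≡0 (gcd[m,n]≡0⇒m≡0 cd≡0))
        (ℤP.∣i∣≡0⇒i≡0 (gcd[m,n]≡0⇒n≡0 ∣ c C ∣ cd≡0))
  where
  ab≡0 = gcd[m,n]≡0⇒m≡0 content≡0
  cd≡0 = gcd[m,n]≡0⇒n≡0 (gcd ∣ a C ∣ ∣ b C ∣) content≡0

exact-quotient : ∀ x g .{{_ : ℕ.NonZero g}} → g ∣ ∣ x ∣ → x ≡ + g * (x /ℕ g)
exact-quotient x g g∣x = begin
  x                             ≡⟨ a≡a%ℕn+[a/ℕn]*n x g ⟩
  + (x %ℕ g) + (x /ℕ g) * + g   ≡⟨ cong (λ r → + r + (x /ℕ g) * + g)
                                        (remainder x (n∣m⇒m%n≡0 _ _ g∣x)) ⟩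
  0ℤ + (x /ℕ g) * + g           ≡⟨ ℤP.+-identityˡ _ ⟩
  (x /ℕ g) * + g                ≡⟨ ℤP.*-comm (x /ℕ g) (+ g) ⟩
  + g * (x /ℕ g)                ∎
  where
  open ≡-Reasoning
  remainder : ∀ x → ∣ x ∣ ℕ.% g ≡ 0 → x %ℕ g ≡ 0
  remainder (+ n)    r≡0 = r≡0
  remainder -[1+ n ] r≡0 with suc n ℕ.% g
  ... | zero = refl

red-cases : ∀ C → (content C ≡ 0 × red C ≡ C) ⊎ (∃[ k ] content C ≡ suc k × C ≡ +[1+ k ] ⊙ red C)
red-cases C with content C in content≡
... | zero  = inj₁ (refl , refl)
... | suc k =
  inj₂ (k , refl , mat-≡ (quotient (a C) ∣a) (quotient (b C) ∣b) (quotient (c C) ∣c) (quotient (d C) ∣d))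
  where
  quotient : ∀ x → content C ∣ ∣ x ∣ → x ≡ +[1+ k ] * (x /ℕ suc k)
  quotient x = exact-quotient x (suc k) ∘ subst (_∣ ∣ x ∣) content≡
  ab = gcd[m,n]∣m (gcd ∣ a C ∣ ∣ b C ∣) (gcd ∣ c C ∣ ∣ d C ∣)
  cd = gcd[m,n]∣n (gcd ∣ a C ∣ ∣ b C ∣) (gcd ∣ c C ∣ ∣ d C ∣)
  ∣a = ∣-trans ab (gcd[m,n]∣m ∣ a C ∣ ∣ b C ∣)
  ∣b = ∣-trans ab (gcd[m,n]∣n ∣ a C ∣ ∣ b C ∣)
  ∣c = ∣-trans cd (gcd[m,n]∣m ∣ c C ∣ ∣ d C ∣)
  ∣d = ∣-trans cd (gcd[m,n]∣n ∣ c C ∣ ∣ d C ∣)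

primitive-red⇒multiple : ∀ C → Primitive (red C) → ∃[ k ] C ≡ +[1+ k ] ⊙ red C
primitive-red⇒multiple C red-primitive with red-cases C
... | inj₁ (content≡0 , red≡id) =
  contradiction (trans (sym content≡0) (trans (cong content (sym red≡id)) red-primitive)) λ ()
... | inj₂ (k , _ , C≡sR) = k , C≡sR

multiple-primitive : ∀ C {k} → content C ≡ suc k → C ≡ +[1+ k ] ⊙ red C → Primitive (red C)
multiple-primitive C {k} content≡ C≡sR = ℕP.*-cancelˡ-≡ (content (red C)) 1 (suc k) (begin
    suc k ℕ.* content (red C)    ≡⟨ content-⊙ (suc k) (red C) ⟨
    content (+[1+ k ] ⊙ red C)   ≡⟨ cong content C≡sR ⟨
    content C                    ≡⟨ content≡ ⟩
    suc k                        ≡⟨ ℕP.*-identityʳ (suc k) ⟨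
    suc k ℕ.* 1                  ∎)
  where open ≡-Reasoning

primitive-part : ∀ C → C ≢ O → Primitive (red C) × ∃[ k ] C ≡ +[1+ k ] ⊙ red C
primitive-part C C≢O = from-cases (red-cases C)
  where
  from-cases : (content C ≡ 0 × red C ≡ C) ⊎ (∃[ k ] content C ≡ suc k × C ≡ +[1+ k ] ⊙ red C) →
               Primitive (red C) × ∃[ k ] C ≡ +[1+ k ] ⊙ red C
  from-cases (inj₁ (content≡0 , _))           = contradiction (content≡0⇒≡O C content≡0) C≢O
  from-cases (inj₂ (k , content≡ , C≡sR)) = multiple-primitive C content≡ C≡sR , k , C≡sR

toℚᵘ-toℚ : ∀ x → ℚ.toℚᵘ (toℚ x) ℚᵘ.≃ ℚᵘ.mkℚᵘ x 0
toℚᵘ-toℚ x = ℚP.toℚᵘ-fromℚᵘ (ℚᵘ.mkℚᵘ x 0)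

toℚ-+ : ∀ x y → toℚ (x + y) ≡ toℚ x ℚ.+ toℚ y
toℚ-+ x y = ℚP.toℚᵘ-injective (begin
  ℚ.toℚᵘ (toℚ (x + y))                    ≈⟨ toℚᵘ-toℚ (x + y) ⟩
  ℚᵘ.mkℚᵘ (x + y) 0                       ≈⟨ ℚᵘ.*≡* (cong (_* + 1) (sym (cong₂ _+_ (ℤP.*-identityʳ x) (ℤP.*-identityʳ y)))) ⟩
  ℚᵘ.mkℚᵘ x 0 ℚᵘ.+ ℚᵘ.mkℚᵘ y 0            ≈⟨ ℚᵘP.+-cong (ℚᵘP.≃-sym (toℚᵘ-toℚ x)) (ℚᵘP.≃-sym (toℚᵘ-toℚ y)) ⟩
  ℚ.toℚᵘ (toℚ x) ℚᵘ.+ ℚ.toℚᵘ (toℚ y)      ≈⟨ ℚᵘP.≃-sym (ℚP.toℚᵘ-homo-+ (toℚ x) (toℚ y)) ⟩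
  ℚ.toℚᵘ (toℚ x ℚ.+ toℚ y)                ∎)
  where open ℚᵘP.≃-Reasoning

toℚ-* : ∀ x y → toℚ (x * y) ≡ toℚ x ℚ.* toℚ y
toℚ-* x y = ℚP.toℚᵘ-injective (begin
  ℚ.toℚᵘ (toℚ (x * y))                    ≈⟨ toℚᵘ-toℚ (x * y) ⟩
  ℚᵘ.mkℚᵘ x 0 ℚᵘ.* ℚᵘ.mkℚᵘ y 0            ≈⟨ ℚᵘP.*-cong (ℚᵘP.≃-sym (toℚᵘ-toℚ x)) (ℚᵘP.≃-sym (toℚᵘ-toℚ y)) ⟩
  ℚ.toℚᵘ (toℚ x) ℚᵘ.* ℚ.toℚᵘ (toℚ y)      ≈⟨ ℚᵘP.≃-sym (ℚP.toℚᵘ-homo-* (toℚ x) (toℚ y)) ⟩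
  ℚ.toℚᵘ (toℚ x ℚ.* toℚ y)                ∎)
  where open ℚᵘP.≃-Reasoning

toℚ-injective : ∀ {x y} → toℚ x ≡ toℚ y → x ≡ y
toℚ-injective {x} {y} eq
  with ℚᵘP.≃-trans (ℚᵘP.≃-sym (toℚᵘ-toℚ x)) (ℚᵘP.≃-trans (ℚP.toℚᵘ-cong eq) (toℚᵘ-toℚ y))
... | ℚᵘ.*≡* x*1≡y*1 = trans (sym (ℤP.*-identityʳ x)) (trans x*1≡y*1 (ℤP.*-identityʳ y))

toℚ-linear : ∀ m n u₁ u₂ → toℚ m ℚ.* toℚ u₁ ℚ.+ toℚ n ℚ.* toℚ u₂ ≡ toℚ (m * u₁ + n * u₂)
toℚ-linear m n u₁ u₂ = sym (trans (toℚ-+ (m * u₁) (n * u₂)) (cong₂ ℚ._+_ (toℚ-* m u₁) (toℚ-* n u₂)))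

proportional⇒multiples : ∀ p q u v .{{_ : ℚ.NonZero u}} → p ℚ.* v ≡ q ℚ.* u →
  p ≡ (p ℚ.÷ u) ℚ.* u × q ≡ (p ℚ.÷ u) ℚ.* v
proportional⇒multiples p q u v pv≡qu = sym p/u*u≡p , sym p/u*v≡q
  where
  open ≡-Reasoning
  p/u*u≡p : (p ℚ.÷ u) ℚ.* u ≡ p
  p/u*u≡p = begin
    (p ℚ.* ℚ.1/ u) ℚ.* u     ≡⟨ ℚP.*-assoc p (ℚ.1/ u) u ⟩
    p ℚ.* (ℚ.1/ u ℚ.* u)     ≡⟨ cong (p ℚ.*_) (ℚP.*-inverseˡ u) ⟩
    p ℚ.* ℚ.1ℚ               ≡⟨ ℚP.*-identityʳ p ⟩
    p                        ∎
  p/u*v≡q : (p ℚ.÷ u) ℚ.* v ≡ q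
  p/u*v≡q = begin
    (p ℚ.* ℚ.1/ u) ℚ.* v     ≡⟨ ℚP.*-assoc p (ℚ.1/ u) v ⟩
    p ℚ.* (ℚ.1/ u ℚ.* v)     ≡⟨ cong (p ℚ.*_) (ℚP.*-comm (ℚ.1/ u) v) ⟩
    p ℚ.* (v ℚ.* ℚ.1/ u)     ≡⟨ ℚP.*-assoc p v (ℚ.1/ u) ⟨
    (p ℚ.* v) ℚ.* ℚ.1/ u     ≡⟨ cong (ℚ._* ℚ.1/ u) pv≡qu ⟩
    (q ℚ.* u) ℚ.* ℚ.1/ u     ≡⟨ ℚP.*-assoc q u (ℚ.1/ u) ⟩
    q ℚ.* (u ℚ.* ℚ.1/ u)     ≡⟨ cong (q ℚ.*_) (ℚP.*-inverseʳ u) ⟩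
    q ℚ.* ℚ.1ℚ               ≡⟨ ℚP.*-identityʳ q ⟩
    q                        ∎

eigenvector-of-cross≡0 : ∀ X u₁ u₂ → u₁ ≢ 0ℤ ⊎ u₂ ≢ 0ℤ → cross X u₁ u₂ ≡ 0ℤ →
  ∃[ μ ] IsEigvec X (toℚ u₁) (toℚ u₂) μ
eigenvector-of-cross≡0 X u₁ u₂ u≢0 cross≡0 = eigenvector u≢0
  where
  p₁ = a X * u₁ + b X * u₂
  p₂ = c X * u₁ + d X * u₂
  proportional : toℚ p₁ ℚ.* toℚ u₂ ≡ toℚ p₂ ℚ.* toℚ u₁
  proportional = trans (sym (toℚ-* p₁ u₂))
    (trans (cong toℚ (ℤP.i-j≡0⇒i≡j (p₁ * u₂) (p₂ * u₁) cross≡0)) (toℚ-* p₂ u₁))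
  eigenvector : u₁ ≢ 0ℤ ⊎ u₂ ≢ 0ℤ → ∃[ μ ] IsEigvec X (toℚ u₁) (toℚ u₂) μ
  eigenvector (inj₁ u₁≢0) =
    let instance _ = ℚ.≢-nonZero (u₁≢0 ∘ toℚ-injective)
        (Xu₁ , Xu₂) = proportional⇒multiples (toℚ p₁) (toℚ p₂) (toℚ u₁) (toℚ u₂) proportional
    in toℚ p₁ ℚ.÷ toℚ u₁ , trans (toℚ-linear (a X) (b X) u₁ u₂) Xu₁ , trans (toℚ-linear (c X) (d X) u₁ u₂) Xu₂
  eigenvector (inj₂ u₂≢0) =
    let instance _ = ℚ.≢-nonZero (u₂≢0 ∘ toℚ-injective)
        (Xu₂ , Xu₁) = proportional⇒multiples (toℚ p₂) (toℚ p₁) (toℚ u₂) (toℚ u₁) (sym proportional)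
    in toℚ p₂ ℚ.÷ toℚ u₂ , trans (toℚ-linear (a X) (b X) u₁ u₂) Xu₁ , trans (toℚ-linear (c X) (d X) u₁ u₂) Xu₂

common-eigenvector-of-cross : ∀ A B u₁ u₂ → u₁ ≢ 0ℤ ⊎ u₂ ≢ 0ℤ →
  cross A u₁ u₂ ≡ 0ℤ → cross B u₁ u₂ ≡ 0ℤ → CommonEigenvector A B
common-eigenvector-of-cross A B u₁ u₂ u≢0 crossA≡0 crossB≡0 =
  toℚ u₁ , toℚ u₂ , nonzero ,
  eigenvector-of-cross≡0 A u₁ u₂ u≢0 crossA≡0 , eigenvector-of-cross≡0 B u₁ u₂ u≢0 crossB≡0
  where
  nonzero : ¬ (toℚ u₁ ≡ ℚ.0ℚ × toℚ u₂ ≡ ℚ.0ℚ)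
  nonzero (u₁≡0 , u₂≡0) =
    [ (λ u₁≢0 → u₁≢0 (toℚ-injective u₁≡0)) , (λ u₂≢0 → u₂≢0 (toℚ-injective u₂≡0)) ]′ u≢0

cross-kernel-row : ∀ X K → trace K ≡ 0ℤ → cross X (- b K) (a K) ≡ - (trace (X · K) * b K) - det K * b X
cross-kernel-row (mat x₁ x₂ x₃ x₄) (mat k₁ k₂ k₃ k₄) traceless
  rewrite inverseʳ-unique k₁ k₄ traceless = identity x₁ x₂ x₃ x₄ k₁ k₂ k₃
  where
  identity : ∀ x₁ x₂ x₃ x₄ k₁ k₂ k₃ →
    (x₁ * - k₂ + x₂ * k₁) * k₁ - (x₃ * - k₂ + x₄ * k₁) * - k₂
    ≡ - (((x₁ * k₁ + x₂ * k₃) + (x₃ * k₂ + x₄ * - k₁)) * k₂) - (k₁ * - k₁ - k₂ * k₃) * x₂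
  identity = solve-∀

cross-kernel-column : ∀ X K → trace K ≡ 0ℤ → cross X (a K) (c K) ≡ trace (X · K) * c K + det K * c X
cross-kernel-column (mat x₁ x₂ x₃ x₄) (mat k₁ k₂ k₃ k₄) traceless
  rewrite inverseʳ-unique k₁ k₄ traceless = identity x₁ x₂ x₃ x₄ k₁ k₂ k₃
  where
  identity : ∀ x₁ x₂ x₃ x₄ k₁ k₂ k₃ →
    (x₁ * k₁ + x₂ * k₃) * k₃ - (x₃ * k₁ + x₄ * k₃) * k₁
    ≡ ((x₁ * k₁ + x₂ * k₃) + (x₃ * k₂ + x₄ * - k₁)) * k₃ + (k₁ * - k₁ - k₂ * k₃) * x₃
  identity = solve-∀

-- u spans ker K, and since X · K ⊕ K · X ≡ trace X ⊙ K ⊕ trace (X · K) ⊙ I for traceless K,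
-- every X with trace (X · K) ≡ 0ℤ preserves ker K.
singular-traceless-kernel : ∀ K → trace K ≡ 0ℤ → det K ≡ 0ℤ → K ≢ O →
  ∃₂ λ u₁ u₂ → (u₁ ≢ 0ℤ ⊎ u₂ ≢ 0ℤ) × (∀ X → trace (X · K) ≡ 0ℤ → cross X u₁ u₂ ≡ 0ℤ)
singular-traceless-kernel K traceless singular K≢O = kernel (a K ℤ.≟ 0ℤ) (b K ℤ.≟ 0ℤ) (c K ℤ.≟ 0ℤ)
  where
  row : ∀ X → trace (X · K) ≡ 0ℤ → cross X (- b K) (a K) ≡ 0ℤ
  row X tXK rewrite cross-kernel-row X K traceless | tXK | singular = refl
  column : ∀ X → trace (X · K) ≡ 0ℤ → cross X (a K) (c K) ≡ 0ℤ
  column X tXK rewrite cross-kernel-column X K traceless | tXK | singular = refl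
  kernel : Dec (a K ≡ 0ℤ) → Dec (b K ≡ 0ℤ) → Dec (c K ≡ 0ℤ) →
    ∃₂ λ u₁ u₂ → (u₁ ≢ 0ℤ ⊎ u₂ ≢ 0ℤ) × (∀ X → trace (X · K) ≡ 0ℤ → cross X u₁ u₂ ≡ 0ℤ)
  kernel (no a≢0)  _         _         = - b K , a K , inj₂ a≢0 , row
  kernel (yes _)   (no b≢0)  _         = - b K , a K , inj₁ (b≢0 ∘ ℤP.neg-injective) , row
  kernel (yes _)   (yes _)   (no c≢0)  = a K , c K , inj₂ c≢0 , column
  kernel (yes a≡0) (yes b≡0) (yes c≡0) =
    contradiction (mat-≡ a≡0 b≡0 c≡0 (trans (inverseʳ-unique (a K) (d K) traceless) (cong -_ a≡0))) K≢O

commutator-singular⇒common-eigenvector : ∀ A B → A · B ≢ B · A → det [ A , B ] ≡ 0ℤ → CommonEigenvector A B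
commutator-singular⇒common-eigenvector A B noncommuting singular =
  let u₁ , u₂ , u≢0 , preserved =
        singular-traceless-kernel [ A , B ] (trace-[,] A B) singular (noncommuting ∘ ⊖≡O⇒≡)
  in common-eigenvector-of-cross A B u₁ u₂ u≢0 (preserved A (trace-A·[A,B] A B)) (preserved B (trace-B·[A,B] A B))

skew-shape : ∀ {N} → SkewSymmetric N → N ≡ mat 0ℤ (b N) (- b N) 0ℤ
skew-shape skew = mat-≡ (x≡-x⇒x≡0 (cong a skew)) refl (cong b skew) (x≡-x⇒x≡0 (cong d skew))

asym-·-skew : ∀ X q → asym (X · mat 0ℤ q (- q) 0ℤ) ≡ q * trace X
asym-·-skew (mat x₁ x₂ x₃ x₄) q = identity x₁ x₂ x₃ x₄ q
  where
  identity : ∀ x₁ x₂ x₃ x₄ q → (x₁ * q + x₂ * 0ℤ) - (x₃ * 0ℤ + x₄ * - q) ≡ q * (x₁ + x₄)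
  identity = solve-∀

asym-·-tr-skew : ∀ X q → asym (X · tr (mat 0ℤ q (- q) 0ℤ)) ≡ - (q * trace X)
asym-·-tr-skew (mat x₁ x₂ x₃ x₄) q = identity x₁ x₂ x₃ x₄ q
  where
  identity : ∀ x₁ x₂ x₃ x₄ q → (x₁ * - q + x₂ * 0ℤ) - (x₃ * 0ℤ + x₄ * q) ≡ - (q * (x₁ + x₄))
  identity = solve-∀

skew-compatible⇒anticommute : ∀ A B N → SkewSymmetric N → ¬ Symmetric N → Compatible A B N →
  A · B ≡ negM (B · A)
skew-compatible⇒anticommute A B N skew nonsymmetric (sym-A , sym-B , sym-BA) =
  anticommute-of-traceless A B (traceless-by-tr A sym-A) (traceless B sym-B) (traceless-by-tr (B · A) sym-BA)
  where
  q = b N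
  N≡ : N ≡ mat 0ℤ q (- q) 0ℤ
  N≡ = skew-shape skew
  q≢0 : q ≢ 0ℤ
  q≢0 q≡0 = nonsymmetric
    (subst Symmetric (sym N≡) (subst (λ t → Symmetric (mat 0ℤ t (- t) 0ℤ)) (sym q≡0) refl))
  traceless : ∀ X → Symmetric (X · N) → trace X ≡ 0ℤ
  traceless X sym-XN = *-cancel-≢0 q≢0 (trans (sym (asym-·-skew X q))
    (symmetric⇒asym≡0 (subst (λ M → Symmetric (X · M)) N≡ sym-XN)))
  traceless-by-tr : ∀ X → Symmetric (X · tr N) → trace X ≡ 0ℤ
  traceless-by-tr X sym-XNᵀ = *-cancel-≢0 q≢0 (ℤP.neg-injective (trans (sym (asym-·-tr-skew X q))
    (symmetric⇒asym≡0 (subst (λ M → Symmetric (X · tr M)) N≡ sym-XNᵀ))))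

-- Q = [A,B]·B·A is trace-orthogonal to B, adj A and adj (B · A), and multiplying by J turns
-- these three trace conditions into the three symmetry conditions.
witness : Mat → Mat → Mat
witness A B = (([ A , B ] · B) · A) · J

witness-compatible : ∀ A B → Compatible A B (witness A B)
witness-compatible A B = asym≡0⇒symmetric asym-A , asym≡0⇒symmetric asym-B , asym≡0⇒symmetric asym-BA
  where
  open ≡-Reasoning
  K = [ A , B ]
  Q = (K · B) · A
  asym-A : asym (A · tr (Q · J)) ≡ 0ℤ
  asym-A = begin
    asym (A · tr (Q · J))     ≡⟨ asym-·-tr-·J A Q ⟩
    - trace (Q · adj A)       ≡⟨ cong -_ (trace-·-·-adj (K · B) A) ⟩
    - (det A * trace (K · B)) ≡⟨ cong (λ t → - (det A * t)) (trans (trace-·-comm K B) (trace-B·[A,B] A B)) ⟩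
    - (det A * 0ℤ)            ≡⟨ cong -_ (ℤP.*-zeroʳ (det A)) ⟩
    0ℤ                        ∎
  asym-B : asym (B · (Q · J)) ≡ 0ℤ
  asym-B = begin
    asym (B · (Q · J))        ≡⟨ cong asym (·-assoc B Q J) ⟨
    asym ((B · Q) · J)        ≡⟨ asym-·J (B · Q) ⟩
    trace (B · Q)             ≡⟨ trace-B·[A,B]·B·A A B ⟩
    0ℤ                        ∎
  asym-BA : asym ((B · A) · tr (Q · J)) ≡ 0ℤ
  asym-BA = begin
    asym ((B · A) · tr (Q · J))            ≡⟨ asym-·-tr-·J (B · A) Q ⟩
    - trace (Q · adj (B · A))              ≡⟨ cong (λ P → - trace (P · adj (B · A))) (·-assoc K B A) ⟩
    - trace ((K · (B · A)) · adj (B · A))  ≡⟨ cong -_ (trace-·-·-adj K (B · A)) ⟩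
    - (det (B · A) * trace K)              ≡⟨ cong (λ t → - (det (B · A) * t)) (trace-[,] A B) ⟩
    - (det (B · A) * 0ℤ)                   ≡⟨ cong -_ (ℤP.*-zeroʳ (det (B · A))) ⟩
    0ℤ                                     ∎

asym-witness : ∀ A B → asym (witness A B) ≡ det [ A , B ]
asym-witness A B = trans (asym-·J (([ A , B ] · B) · A)) (trace-[A,B]·B·A A B)

det-witness : ∀ A B → det (witness A B) ≡ det [ A , B ] * det B * det A
det-witness A B = begin
  det ((([ A , B ] · B) · A) · J)      ≡⟨ det-· (([ A , B ] · B) · A) J ⟩
  det (([ A , B ] · B) · A) * 1ℤ       ≡⟨ ℤP.*-identityʳ _ ⟩
  det (([ A , B ] · B) · A)            ≡⟨ det-· ([ A , B ] · B) A ⟩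
  det ([ A , B ] · B) * det A          ≡⟨ cong (_* det A) (det-· [ A , B ] B) ⟩
  det [ A , B ] * det B * det A        ∎
  where open ≡-Reasoning

scaled-witness-admissible : ∀ A B s .{{_ : ℤ.NonZero s}} N → witness A B ≡ s ⊙ N →
  det A ≢ 0ℤ → det B ≢ 0ℤ → det [ A , B ] ≢ 0ℤ → A · B ≢ negM (B · A) →
  det N ≢ 0ℤ × ¬ Symmetric N × ¬ SkewSymmetric N × Compatible A B N
scaled-witness-admissible A B s N N₀≡sN detA≢0 detB≢0 detK≢0 anticommuting≢ =
  detN≢0 , N-nonsymmetric , N-nonskew , N-compatible
  where
  open ≡-Reasoning
  detN≢0 : det N ≢ 0ℤ
  detN≢0 detN≡0 = *-≢0 (*-≢0 detK≢0 detB≢0) detA≢0 (begin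
    det [ A , B ] * det B * det A  ≡⟨ det-witness A B ⟨
    det (witness A B)              ≡⟨ cong det N₀≡sN ⟩
    det (s ⊙ N)                    ≡⟨ det-⊙ s N ⟩
    s * s * det N                  ≡⟨ cong (s * s *_) detN≡0 ⟩
    s * s * 0ℤ                     ≡⟨ ℤP.*-zeroʳ (s * s) ⟩
    0ℤ                             ∎)
  N-compatible : Compatible A B N
  N-compatible = compatible-⊙-cancel s A B N (subst (Compatible A B) N₀≡sN (witness-compatible A B))
  N-nonsymmetric : ¬ Symmetric N
  N-nonsymmetric sym-N = detK≢0 (trans (sym (asym-witness A B))
    (symmetric⇒asym≡0 (subst Symmetric (sym N₀≡sN) (symmetric-⊙ s sym-N))))
  N-nonskew : ¬ SkewSymmetric N
  N-nonskew skew = anticommuting≢ (skew-compatible⇒anticommute A B N skew N-nonsymmetric N-compatible)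

admissible-witness : ∀ A B → det A ≢ 0ℤ → det B ≢ 0ℤ → det [ A , B ] ≢ 0ℤ → A · B ≢ negM (B · A) →
  ∃[ N ] InP N × ¬ Symmetric N × ¬ SkewSymmetric N × Compatible A B N
admissible-witness A B detA≢0 detB≢0 detK≢0 anticommuting≢ =
  let N-primitive , k , N₀≡sN = primitive-part (witness A B) N₀≢O
      detN≢0 , properties = scaled-witness-admissible A B +[1+ k ] (red (witness A B)) N₀≡sN
                              detA≢0 detB≢0 detK≢0 anticommuting≢
  in red (witness A B) , (N-primitive , detN≢0) , properties
  where
  N₀≢O : witness A B ≢ O
  N₀≢O N₀≡O = detK≢0 (trans (sym (asym-witness A B)) (cong asym N₀≡O))

fibonacci-multiples : ∀ (W : ℕ → Mat) → FibonacciInP W →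
  ∀ i → 1 ≤ i → ∃[ k ] W (suc i) · W i ≡ +[1+ k ] ⊙ W (suc (suc i))
fibonacci-multiples W (in-𝒫 , recurrence) i i≥1 =
  subst (λ R → ∃[ k ] W (suc i) · W i ≡ +[1+ k ] ⊙ R) (sym (recurrence i i≥1))
    (primitive-red⇒multiple (W (suc i) · W i) (subst Primitive (recurrence i i≥1) W₂₊ᵢ-primitive))
  where
  W₂₊ᵢ-primitive : Primitive (W (suc (suc i)))
  W₂₊ᵢ-primitive = proj₁ (in-𝒫 (suc (suc i)) (s≤s z≤n))

lemma4p4 : (W : ℕ → Mat) → FibonacciInP W →
    ¬ CommonEigenvector (W 1) (W 2) →
    (W 1 · W 2) ≢ (W 2 · W 1) →
    (W 1 · W 2) ≢ negM (W 2 · W 1) →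
    Admissible W
lemma4p4 W fib no-common-eigenvector noncommuting non-anticommuting =
  let N , N∈𝒫 , N-nonsymmetric , N-nonskew , N-compatible =
        admissible-witness (W 1) (W 2) (nonsingular 0) (nonsingular 1)
          (no-common-eigenvector ∘ commutator-singular⇒common-eigenvector (W 1) (W 2) noncommuting)
          non-anticommuting
  in N , N∈𝒫 , N-nonsymmetric , N-nonskew , compatible-everywhere W N (fibonacci-multiples W fib) N-compatible
  where
  nonsingular : ∀ i → det (W (suc i)) ≢ 0ℤ
  nonsingular i = proj₂ (proj₁ fib (suc i) (s≤s z≤n))
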